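{- Let $\epsilon=\frac1{21}$, $\delta=8\epsilon$, and for an integer $x$ let $f(x)=(9+\epsilon)x-4\binom{x}{2}$. If $G$ is a $5$-critical graph, $R\subsetneq V(G)$ with $|R|\ge 5$, and $R'$ is a critical extension of $R$ with extender $W$ and core $X$, then $$p_G(R')\le p_G(R)+p(W)-f(|X|)+\delta\bigl(T(W)-T(W\setminus X)\bigr).$$ Furthermore, $p_G(R')\le p_G(R)+p(W)-9-\epsilon+\delta$.
   Context: All graphs are finite and simple; $5$-critical means not $4$-colorable but every proper subgraph is $4$-colorable. $T(G)$ is the maximum, over subgraphs $H$ of $G$ that are vertex-disjoint unions of cliques of size three or four, of the number of $K_3$-components plus twice the number of $K_4$-components of $H$. The potential is $p(G)=(9+\epsilon)|V(G)|-4|E(G)|-\delta T(G)$ and $p_G(R)=p(G[R])$. For $R\subsetneq V(G)$ with $|R|\ge 5$ and a $4$-coloring $\phi$ of $G[R]$, $G_\phi(R)$ is obtained from $G$ by identifying, for each color $i\in\{1,2,3,4\}$, the vertices of $R$ colored $i$ to a vertex $x_i$, adding all edges $x_ix_j$, and deleting parallel edges; let $X_0$ be the graph on the $x_i$. If $W$ is a $5$-critical subgraph of $G_\phi(R)$, then $R'=(V(W)\setminus V(X_0))\cup R$ is a critical extension of $R$ with extender $W$ and core $X=W\cap X_0$; $W\setminus X$ denotes $W$ with the vertices of the core removed. -}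

module Defs where

open import Data.Bool using (Bool; true; false; _∧_; _∨_; not; if_then_else_)
open import Data.Nat as ℕ using (ℕ; zero; suc; _<ᵇ_; _≥_)
open import Data.Nat.Combinatorics using (_C_)
open import Data.Fin using (Fin; toℕ; splitAt; _↑ˡ_)
open import Data.Fin.Properties using (_≟_)
open import Data.Sum using (_⊎_; inj₁; inj₂)
open import Data.Product using (Σ; _×_; ∃; ∃-syntax; _,_)
open import Data.List using (List; length; concat; map)
open import Data.Nat.ListAction using (sum)
open import Data.List.Membership.Propositional using (_∈_)
open import Data.List.Relation.Unary.All using (All)
open import Data.List.Relation.Unary.Unique.Propositional using (Unique)
open import Data.Integer using (+_)
open import Data.Rational using (ℚ; _/_; _+_; _-_; _*_; _≤_)
open import Relation.Nullary using (¬_; ⌊_⌋)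
open import Relation.Binary.PropositionalEquality using (_≡_; _≢_)

countF : ∀ {n} → (Fin n → Bool) → ℕ
countF {zero}  f = 0
countF {suc n} f = (if f Fin.zero then 1 else 0) ℕ.+ countF (λ i → f (Fin.suc i))
  where import Data.Fin as Fin

sumF : ∀ {n} → (Fin n → ℕ) → ℕ
sumF {zero}  f = 0
sumF {suc n} f = f Fin.zero ℕ.+ sumF (λ i → f (Fin.suc i))
  where import Data.Fin as Fin

anyF : ∀ {n} → (Fin n → Bool) → Bool
anyF {zero}  f = false
anyF {suc n} f = f Fin.zero ∨ anyF (λ i → f (Fin.suc i))
  where import Data.Fin as Fin

eqᵇ : ∀ {n} → Fin n → Fin n → Bool
eqᵇ i j = ⌊ i ≟ j ⌋

-- A graph is given by a vertex subset V and a Boolean matrix E; its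
-- actual (simple, undirected) adjacency relation is the normalisation
-- Adj below: u ~ v iff u ≠ v, both are vertices, and E u v or E v u.
-- Hence every such record is a finite simple graph, and all notions
-- below are defined only through V and Adj.

record Graph (n : ℕ) : Set where
  constructor graph
  field
    V : Fin n → Bool
    E : Fin n → Fin n → Bool
open Graph public

Adj : ∀ {n} → Graph n → Fin n → Fin n → Bool
Adj G u v = V G u ∧ V G v ∧ not (eqᵇ u v) ∧ (E G u v ∨ E G v u)

nV : ∀ {n} → Graph n → ℕ
nV G = countF (V G)

nE : ∀ {n} → Graph n → ℕ
nE G = sumF (λ u → countF (λ v → (toℕ u <ᵇ toℕ v) ∧ Adj G u v))

_⊆G_ : ∀ {n} → Graph n → Graph n → Set
H ⊆G G = (∀ v → V H v ≡ true → V G v ≡ true)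
       × (∀ u v → Adj H u v ≡ true → Adj G u v ≡ true)

_⊂G_ : ∀ {n} → Graph n → Graph n → Set
H ⊂G G = H ⊆G G
       × ((∃[ v ] (V G v ≡ true × V H v ≡ false))
          ⊎ (∃[ u ] ∃[ v ] (Adj G u v ≡ true × Adj H u v ≡ false)))

Colouring : ∀ {n} → ℕ → Graph n → Set
Colouring {n} k G =
  Σ (Fin n → Fin k) λ c → ∀ u v → Adj G u v ≡ true → c u ≢ c v

Colourable : ∀ {n} → ℕ → Graph n → Set
Colourable k G = Colouring k G

Critical5 : ∀ {n} → Graph n → Set
Critical5 {n} G = ¬ Colourable 4 G × (∀ (H : Graph n) → H ⊂G G → Colourable 4 H)

induced : ∀ {n} → Graph n → (Fin n → Bool) → Graph n
induced G R = graph (λ v → V G v ∧ R v) (E G)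

-- T(G): subgraphs that are vertex-disjoint unions of K3's and K4's are
-- given by the list of their components (each a list of distinct,
-- pairwise adjacent vertices of size 3 or 4; components are
-- vertex-disjoint).  Such a subgraph has value #K3 + 2 #K4.

IsK3orK4 : ∀ {n} → Graph n → List (Fin n) → Set
IsK3orK4 G c = (length c ≡ 3 ⊎ length c ≡ 4)
             × All (λ v → V G v ≡ true) c
             × (∀ u v → u ∈ c → v ∈ c → u ≢ v → Adj G u v ≡ true)

record CliquePacking {n} (G : Graph n) : Set where
  field
    comps    : List (List (Fin n))
    isClique : All (IsK3orK4 G) comps
    disjoint : Unique (concat comps)

weightK : ℕ → ℕ
weightK 3 = 1
weightK 4 = 2
weightK _ = 0

packValue : ∀ {n} {G : Graph n} → CliquePacking G → ℕ
packValue P = sum (map (λ c → weightK (length c)) (CliquePacking.comps P))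

IsT : ∀ {n} → Graph n → ℕ → Set
IsT G t = (Σ (CliquePacking G) λ P → packValue P ≡ t)
        × (∀ (P : CliquePacking G) → packValue P ℕ.≤ t)

ℕ→ℚ : ℕ → ℚ
ℕ→ℚ m = + m / 1

ε : ℚ
ε = + 1 / 21

δ : ℚ
δ = ℕ→ℚ 8 * ε

-- p(G) with T(G) = t supplied (see IsT)
pot : ∀ {n} → Graph n → ℕ → ℚ
pot G t = (ℕ→ℚ 9 + ε) * ℕ→ℚ (nV G) - ℕ→ℚ 4 * ℕ→ℚ (nE G) - δ * ℕ→ℚ t

f : ℕ → ℚ
f x = (ℕ→ℚ 9 + ε) * ℕ→ℚ x - ℕ→ℚ 4 * ℕ→ℚ (x C 2)

-- G_φ(R) on the ground set Fin (n + 4): old vertex v ↦ v ↑ˡ 4,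
-- new vertex x_i ↦ n ↑ʳ i.  Old vertices are those of V(G) \ R.

isOld : ∀ {n} → Fin (n ℕ.+ 4) → Bool
isOld {n} a with splitAt n a
... | inj₁ _ = true
... | inj₂ _ = false

Gφ : ∀ {n} → Graph n → (Fin n → Bool) → (Fin n → Fin 4) → Graph (n ℕ.+ 4)
Gφ {n} G R φ = graph Vφ Eφ
  where
  toCol : Fin n → Fin 4 → Bool
  toCol u i = anyF (λ w → R w ∧ eqᵇ (φ w) i ∧ Adj G u w)
  Vφ : Fin (n ℕ.+ 4) → Bool
  Vφ a with splitAt n a
  ... | inj₁ u = V G u ∧ not (R u)
  ... | inj₂ i = true
  Eφ : Fin (n ℕ.+ 4) → Fin (n ℕ.+ 4) → Bool
  Eφ a b with splitAt n a | splitAt n b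
  ... | inj₁ u | inj₁ v = Adj G u v
  ... | inj₁ u | inj₂ i = toCol u i
  ... | inj₂ i | inj₁ u = toCol u i
  ... | inj₂ i | inj₂ j = not (eqᵇ i j)

coreSize : ∀ {n} → Graph (n ℕ.+ 4) → ℕ
coreSize W = countF (λ a → V W a ∧ not (isOld a))

minusCore : ∀ {n} → Graph (n ℕ.+ 4) → Graph (n ℕ.+ 4)
minusCore W = graph (λ a → V W a ∧ isOld a) (E W)

extension : ∀ {n} → (Fin n → Bool) → Graph (n ℕ.+ 4) → Fin n → Bool
extension R W v = R v ∨ V W (v ↑ˡ 4)

module Submission where

-- The potential is linear in the numbers of vertices, edges and T, so the first bound follows
-- from three counting facts relating G[R], W, W ∖ X and G[R'] (module Potential):
--   (1) |R'| + |X| = |R| + |V(W)|, since V(W) ∖ X = R' ∖ R;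
--   (2) e(G[R]) + e(W) ≤ e(G[R']) + C(|X|,2), counting ordered adjacent pairs by the kind of
--       their ends: edges of W among old vertices are edges of G[R' ∖ R]; an old vertex has at
--       most as many neighbours in X as in R (colour classes of φ); X spans at most C(|X|,2) edges;
--   (3) T(G[R]) + T(W ∖ X) ≤ T(G[R']), joining disjoint clique packings.
-- The second bound follows from T(W) ≤ T(W ∖ X) + |X| (deleting a vertex costs at most one unit
-- of a clique packing), 1 ≤ |X| ≤ 4 (an empty core would make W 4-colourable) and a numerical
-- check of f(k) - δk ≥ 9 + ε - δ for k = 1, …, 4.

open import Defs
open import Data.Bool using (Bool)
open import Data.Nat using (ℕ)
import Data.Nat as ℕ
open import Data.Fin using (Fin)

module Booleans where

  open import Data.Bool using (true; false; _∧_; _∨_; if_then_else_)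
  open import Data.Bool.Properties using (∧-identityʳ; ∧-zeroʳ)
  open import Data.Nat using (_+_; _*_; _≤_; z≤n; s≤s)
  import Data.Nat.Properties as ℕₚ
  open import Data.Nat.Tactic.RingSolver using (solve-∀)
  open import Data.Fin using (suc)
  open import Data.Fin.Properties using (_≟_)
  open import Data.Product using (_×_; _,_)
  open import Data.Sum using (_⊎_; inj₁; inj₂)
  open import Data.Empty using (⊥-elim)
  open import Relation.Nullary using (yes; no)
  open import Relation.Binary.PropositionalEquality

  ind : Bool → ℕ
  ind b = if b then 1 else 0

  ∧-elim : ∀ {x y} → x ∧ y ≡ true → x ≡ true × y ≡ true
  ∧-elim {true} {true} _ = refl , refl

  ∨-elim : ∀ {x y} → x ∨ y ≡ true → x ≡ true ⊎ y ≡ true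
  ∨-elim {true}         _ = inj₁ refl
  ∨-elim {false} {true} _ = inj₂ refl

  ind≤1 : ∀ b → ind b ≤ 1
  ind≤1 true  = s≤s z≤n
  ind≤1 false = z≤n

  ind-mono : ∀ {a b} → (a ≡ true → b ≡ true) → ind a ≤ ind b
  ind-mono {false} a⇒b = z≤n
  ind-mono {true}  a⇒b rewrite a⇒b refl = s≤s z≤n

  ind-∧ : ∀ a b → ind (a ∧ b) ≡ ind a * ind b
  ind-∧ true  b = sym (ℕₚ.+-identityʳ (ind b))
  ind-∧ false b = refl

  ind-∨ : ∀ {a b} → (b ≡ true → a ≡ false) → ind (a ∨ b) ≡ ind a + ind b
  ind-∨ {a}     {true}  b⇒¬a rewrite b⇒¬a refl = refl
  ind-∨ {true}  {false} _ = refl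
  ind-∨ {false} {false} _ = refl

  ind-expand : ∀ a {r₁ o₁ r₂ o₂} → (o₁ ≡ true → r₁ ≡ false) → (o₂ ≡ true → r₂ ≡ false) →
    ind (a ∧ ((r₁ ∨ o₁) ∧ (r₂ ∨ o₂)))
      ≡ ind (a ∧ (r₁ ∧ r₂)) + ind (a ∧ (o₁ ∧ o₂)) + ind (a ∧ (o₁ ∧ r₂)) + ind (a ∧ (r₁ ∧ o₂))
  ind-expand a {r₁} {o₁} {r₂} {o₂} h₁ h₂ = begin
    ind (a ∧ ((r₁ ∨ o₁) ∧ (r₂ ∨ o₂)))
      ≡⟨ ind-∧∧ a (r₁ ∨ o₁) (r₂ ∨ o₂) ⟩
    ind a * (ind (r₁ ∨ o₁) * ind (r₂ ∨ o₂))
      ≡⟨ cong₂ (λ x y → ind a * (x * y)) (ind-∨ h₁) (ind-∨ h₂) ⟩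
    ind a * ((ind r₁ + ind o₁) * (ind r₂ + ind o₂))
      ≡⟨ expand (ind a) (ind r₁) (ind o₁) (ind r₂) (ind o₂) ⟩
    ind a * (ind r₁ * ind r₂) + ind a * (ind o₁ * ind o₂) + ind a * (ind o₁ * ind r₂) + ind a * (ind r₁ * ind o₂)
      ≡⟨ sym (cong₂ _+_ (cong₂ _+_ (cong₂ _+_ (ind-∧∧ a r₁ r₂) (ind-∧∧ a o₁ o₂)) (ind-∧∧ a o₁ r₂))
                        (ind-∧∧ a r₁ o₂)) ⟩
    ind (a ∧ (r₁ ∧ r₂)) + ind (a ∧ (o₁ ∧ o₂)) + ind (a ∧ (o₁ ∧ r₂)) + ind (a ∧ (r₁ ∧ o₂)) ∎
    where
    open ≡-Reasoning
    ind-∧∧ : ∀ a x y → ind (a ∧ (x ∧ y)) ≡ ind a * (ind x * ind y)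
    ind-∧∧ a x y = trans (ind-∧ a (x ∧ y)) (cong (ind a *_) (ind-∧ x y))
    expand : ∀ a r o r′ o′ →
      a * ((r + o) * (r′ + o′)) ≡ a * (r * r′) + a * (o * o′) + a * (o * r′) + a * (r * o′)
    expand = solve-∀

  ind-split : ∀ x y a → (a ≡ true → ind x + ind y ≡ 1) → ind a ≡ ind (x ∧ a) + ind (y ∧ a)
  ind-split x y false _ rewrite ∧-zeroʳ x | ∧-zeroʳ y = refl
  ind-split x y true one rewrite ∧-identityʳ x | ∧-identityʳ y = sym (one refl)

  eqᵇ-refl : ∀ {n} (i : Fin n) → eqᵇ i i ≡ true
  eqᵇ-refl i with i ≟ i
  ... | yes _   = refl
  ... | no  i≢i = ⊥-elim (i≢i refl)

  eqᵇ-≢ : ∀ {n} {i j : Fin n} → i ≢ j → eqᵇ i j ≡ false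
  eqᵇ-≢ {i = i} {j} i≢j with i ≟ j
  ... | yes i≡j = ⊥-elim (i≢j i≡j)
  ... | no  _   = refl

  eqᵇ-sym : ∀ {n} (i j : Fin n) → eqᵇ i j ≡ eqᵇ j i
  eqᵇ-sym i j with i ≟ j
  ... | yes refl = sym (eqᵇ-refl i)
  ... | no  i≢j  = sym (eqᵇ-≢ (λ j≡i → i≢j (sym j≡i)))

  -- Not a definitional equality: eqᵇ inspects a decision procedure built by map′.
  eqᵇ-suc : ∀ {n} (i j : Fin n) → eqᵇ (suc i) (suc j) ≡ eqᵇ i j
  eqᵇ-suc i j with i ≟ j
  ... | yes _ = refl
  ... | no  _ = refl

module FiniteSums where

  open Booleans
  open import Data.Bool using (true; false; _∧_; not)
  open import Data.Bool.Properties using (∧-identityʳ; ∧-zeroʳ; ∧-comm)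
  open import Data.Nat using (zero; suc; _+_; _*_; _≤_; z≤n; s≤s)
  import Data.Nat.Properties as ℕₚ
  open import Data.Nat.Combinatorics using (_C_; nC1≡n; nCk+nC[k+1]≡[n+1]C[k+1])
  open import Data.Nat.Tactic.RingSolver using (solve-∀)
  open import Data.Fin using (zero; suc; _↑ˡ_; _↑ʳ_)
  open import Data.List using (List; []; _∷_; length)
  open import Data.List.Relation.Unary.All as All using (All; []; _∷_)
  open import Data.List.Relation.Unary.AllPairs using ([]; _∷_)
  open import Data.List.Relation.Unary.Unique.Propositional using (Unique)
  open import Data.Product using (_×_; _,_; ∃-syntax)
  open import Relation.Binary.PropositionalEquality
  open import Algebra.Properties.CommutativeMonoid.Sum ℕₚ.+-0-commutativeMonoid public
    using (sum; sum-cong-≗; ∑-distrib-+; ∑-comm; sum-replicate-zero)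

  sumF≡sum : ∀ {n} (g : Fin n → ℕ) → sumF g ≡ sum g
  sumF≡sum {zero}  g = refl
  sumF≡sum {suc n} g = cong (g zero +_) (sumF≡sum (λ i → g (suc i)))

  countF≡sum : ∀ {n} (p : Fin n → Bool) → countF p ≡ sum (λ i → ind (p i))
  countF≡sum {zero}  p = refl
  countF≡sum {suc n} p = cong (ind (p zero) +_) (countF≡sum (λ i → p (suc i)))

  countF-cong : ∀ {n} {p q : Fin n → Bool} → (∀ i → p i ≡ q i) → countF p ≡ countF q
  countF-cong {p = p} {q} p≗q =
    trans (countF≡sum p) (trans (sum-cong-≗ (λ i → cong ind (p≗q i))) (sym (countF≡sum q)))

  countF-witness : ∀ {n} (p : Fin n → Bool) → 1 ≤ countF p → ∃[ i ] p i ≡ true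
  countF-witness {suc n} p pos with p zero in p₀
  ... | true  = zero , p₀
  ... | false = let (i , pᵢ) = countF-witness (λ i → p (suc i)) pos in suc i , pᵢ

  ∑-mono : ∀ {n} {g h : Fin n → ℕ} → (∀ i → g i ≤ h i) → sum g ≤ sum h
  ∑-mono {zero}  g≤h = z≤n
  ∑-mono {suc n} g≤h = ℕₚ.+-mono-≤ (g≤h zero) (∑-mono (λ i → g≤h (suc i)))

  ∑-zero : ∀ {n} {g : Fin n → ℕ} → (∀ i → g i ≡ 0) → sum g ≡ 0
  ∑-zero {n} g≗0 = trans (sum-cong-≗ g≗0) (sum-replicate-zero n)

  term≤∑ : ∀ {n} (g : Fin n → ℕ) i → g i ≤ sum g
  term≤∑ g zero    = ℕₚ.m≤m+n (g zero) _
  term≤∑ g (suc i) = ℕₚ.≤-trans (term≤∑ (λ j → g (suc j)) i) (ℕₚ.m≤n+m _ (g zero))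

  ∑-splitAt : ∀ m k (g : Fin (m + k) → ℕ) →
    sum g ≡ sum (λ i → g (i ↑ˡ k)) + sum (λ j → g (m ↑ʳ j))
  ∑-splitAt zero    k g = refl
  ∑-splitAt (suc m) k g =
    trans (cong (g zero +_) (∑-splitAt m k (λ i → g (suc i)))) (sym (ℕₚ.+-assoc (g zero) _ _))

  ∑∑ : ∀ {a b} → (Fin a → Fin b → ℕ) → ℕ
  ∑∑ f = sum (λ i → sum (λ j → f i j))

  ∑∑-cong : ∀ {a b} {f g : Fin a → Fin b → ℕ} → (∀ i j → f i j ≡ g i j) → ∑∑ f ≡ ∑∑ g
  ∑∑-cong f≗g = sum-cong-≗ (λ i → sum-cong-≗ (f≗g i))

  ∑∑-mono : ∀ {a b} {f g : Fin a → Fin b → ℕ} → (∀ i j → f i j ≤ g i j) → ∑∑ f ≤ ∑∑ g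
  ∑∑-mono f≤g = ∑-mono (λ i → ∑-mono (f≤g i))

  ∑∑-distrib-+ : ∀ {a b} (f g : Fin a → Fin b → ℕ) → ∑∑ (λ i j → f i j + g i j) ≡ ∑∑ f + ∑∑ g
  ∑∑-distrib-+ f g =
    trans (sum-cong-≗ (λ i → ∑-distrib-+ (f i) (g i))) (∑-distrib-+ (λ i → sum (f i)) (λ i → sum (g i)))

  ∑∑-transpose : ∀ {a b} (f : Fin a → Fin b → ℕ) → ∑∑ f ≡ ∑∑ (λ j i → f i j)
  ∑∑-transpose f = ∑-comm f

  ∑-one-hot : ∀ {n} (c : Fin n) b → sum (λ j → ind (eqᵇ c j ∧ b)) ≡ ind b
  ∑-one-hot {suc n} zero    b = trans (cong (ind b +_) (sum-replicate-zero n)) (ℕₚ.+-identityʳ (ind b))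
  ∑-one-hot {suc n} (suc c) b =
    trans (sum-cong-≗ (λ j → cong (λ e → ind (e ∧ b)) (eqᵇ-suc c j))) (∑-one-hot c b)

  ∑-∧ˡ : ∀ {n} b (p : Fin n → Bool) → sum (λ i → ind (b ∧ p i)) ≡ ind b * countF p
  ∑-∧ˡ     true  p = trans (sym (countF≡sum p)) (sym (ℕₚ.+-identityʳ (countF p)))
  ∑-∧ˡ {n} false p = sum-replicate-zero n

  anyF≤count : ∀ {n} (p : Fin n → Bool) → ind (anyF p) ≤ sum (λ i → ind (p i))
  anyF≤count {zero}  p = z≤n
  anyF≤count {suc n} p with p zero
  ... | true  = s≤s z≤n
  ... | false = anyF≤count (λ i → p (suc i))

  ordered-pairs : ∀ {m} (X : Fin m → Bool) →
    ∑∑ (λ i j → ind (not (eqᵇ i j) ∧ (X i ∧ X j))) ≡ 2 * (countF X C 2)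
  ordered-pairs {zero}  X = refl
  ordered-pairs {suc m} X = begin
    sum (λ j → ind (x₀ ∧ Y j)) + sum (λ i → ind (Y i ∧ x₀) + sum (λ j → pair (suc i) (suc j)))
      ≡⟨ cong (sum (λ j → ind (x₀ ∧ Y j)) +_)
              (∑-distrib-+ (λ i → ind (Y i ∧ x₀)) (λ i → sum (λ j → pair (suc i) (suc j)))) ⟩
    sum (λ j → ind (x₀ ∧ Y j)) + (sum (λ i → ind (Y i ∧ x₀)) + ∑∑ (λ i j → pair (suc i) (suc j)))
      ≡⟨ cong₂ (λ a b → a + (b + ∑∑ (λ i j → pair (suc i) (suc j)))) (∑-∧ˡ x₀ Y)
           (trans (sum-cong-≗ (λ i → cong ind (∧-comm (Y i) x₀))) (∑-∧ˡ x₀ Y)) ⟩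
    ind x₀ * K + (ind x₀ * K + ∑∑ (λ i j → pair (suc i) (suc j)))
      ≡⟨ cong (λ s → ind x₀ * K + (ind x₀ * K + s))
           (trans (∑∑-cong (λ i j → cong (λ e → ind (not e ∧ (Y i ∧ Y j))) (eqᵇ-suc i j)))
                  (ordered-pairs Y)) ⟩
    ind x₀ * K + (ind x₀ * K + 2 * (K C 2))
      ≡⟨ add-element x₀ ⟩
    2 * ((ind x₀ + K) C 2) ∎
    where
    open ≡-Reasoning
    pair : Fin (suc m) → Fin (suc m) → ℕ
    pair i j = ind (not (eqᵇ i j) ∧ (X i ∧ X j))
    x₀ : Bool
    x₀ = X zero
    Y : Fin m → Bool
    Y i = X (suc i)
    K : ℕ
    K = countF Y
    -- Pascal's rule C(K+1, 2) = K + C(K, 2) accounts for the pairs containing element zero.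
    add-element : ∀ b → ind b * K + (ind b * K + 2 * (K C 2)) ≡ 2 * ((ind b + K) C 2)
    add-element false = refl
    add-element true  = trans (double K (K C 2))
      (cong (2 *_) (trans (cong (_+ K C 2) (sym (nC1≡n K))) (nCk+nC[k+1]≡[n+1]C[k+1] K 1)))
      where
      double : ∀ a c → 1 * a + (1 * a + 2 * c) ≡ 2 * (a + c)
      double = solve-∀

  countF-remove : ∀ {n} (p : Fin n → Bool) x → p x ≡ true →
    countF p ≡ suc (countF (λ a → p a ∧ not (eqᵇ a x)))
  countF-remove {suc n} p zero px =
    trans (cong (λ b → ind b + countF (λ i → p (suc i))) px)
          (cong (1 +_) (cong₂ _+_ (cong ind (sym (∧-zeroʳ (p zero))))
                                  (countF-cong (λ i → sym (∧-identityʳ (p (suc i)))))))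
  countF-remove {suc n} p (suc x) px = begin
    ind (p zero) + countF (λ a → p (suc a))
      ≡⟨ cong (ind (p zero) +_) (countF-remove (λ a → p (suc a)) x px) ⟩
    ind (p zero) + suc (countF (λ a → p (suc a) ∧ not (eqᵇ a x)))
      ≡⟨ ℕₚ.+-suc (ind (p zero)) _ ⟩
    suc (ind (p zero) + countF (λ a → p (suc a) ∧ not (eqᵇ a x)))
      ≡⟨ cong (1 +_) (cong₂ _+_ (cong ind (sym (∧-identityʳ (p zero))))
                            (countF-cong (λ a → cong (λ e → p (suc a) ∧ not e) (sym (eqᵇ-suc a x))))) ⟩
    suc (ind (p zero ∧ true) + countF (λ a → p (suc a) ∧ not (eqᵇ (suc a) (suc x)))) ∎
    where open ≡-Reasoning

  unique⇒length≤countF : ∀ {n} (p : Fin n → Bool) {xs : List (Fin n)} →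
    Unique xs → All (λ a → p a ≡ true) xs → length xs ≤ countF p
  unique⇒length≤countF p {[]}     _              _          = z≤n
  unique⇒length≤countF p {x ∷ xs} (x∉xs ∷ uniq) (px ∷ pxs) =
    subst (suc (length xs) ≤_) (sym (countF-remove p x px))
          (s≤s (unique⇒length≤countF _ uniq (All.zipWith still-counted (x∉xs , pxs))))
    where
    still-counted : ∀ {a} → x ≢ a × p a ≡ true → p a ∧ not (eqᵇ a x) ≡ true
    still-counted (x≢a , pa) rewrite pa | eqᵇ-≢ (λ a≡x → x≢a (sym a≡x)) = refl

module Graphs where

  open Booleans
  open FiniteSums
  open import Data.Bool using (true; false; _∧_; _∨_; not; T)
  open import Data.Bool.Properties using (∨-comm)
  open import Data.Bool.Solver using (module ∨-∧-Solver)
  open import Data.Nat using (_+_; _*_; _<_; _≤_; _<ᵇ_)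
  import Data.Nat.Properties as ℕₚ
  open import Data.Fin using (toℕ)
  open import Data.Fin.Properties using (toℕ-injective)
  open import Data.Product using (_×_; _,_; proj₁; proj₂)
  open import Data.Unit using (tt)
  open import Data.Empty using (⊥-elim)
  open import Relation.Binary.PropositionalEquality

  Adj-sym : ∀ {n} (G : Graph n) u v → Adj G u v ≡ Adj G v u
  Adj-sym G u v = begin
    V G u ∧ V G v ∧ not (eqᵇ u v) ∧ (E G u v ∨ E G v u)
      ≡⟨ cong₂ (λ e f → V G u ∧ V G v ∧ not e ∧ f) (eqᵇ-sym u v) (∨-comm (E G u v) (E G v u)) ⟩
    V G u ∧ V G v ∧ not (eqᵇ v u) ∧ (E G v u ∨ E G u v)
      ≡⟨ solve 3 (λ a b c → a :* (b :* c) := b :* (a :* c)) refl (V G u) (V G v) _ ⟩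
    V G v ∧ V G u ∧ not (eqᵇ v u) ∧ (E G v u ∨ E G u v) ∎
    where open ≡-Reasoning
          open ∨-∧-Solver

  private
    adj-parts : ∀ {n} (G : Graph n) {u v} → Adj G u v ≡ true →
      V G u ≡ true × V G v ≡ true × not (eqᵇ u v) ≡ true × (E G u v ∨ E G v u) ≡ true
    adj-parts G {u} {v} adj =
      let (Vu , r₁) = ∧-elim {V G u} adj
          (Vv , r₂) = ∧-elim {V G v} r₁
          (ne , e)  = ∧-elim {not (eqᵇ u v)} r₂
      in Vu , Vv , ne , e

  adj-ends : ∀ {n} (G : Graph n) {u v} → Adj G u v ≡ true → V G u ≡ true × V G v ≡ true
  adj-ends G adj = let (Vu , Vv , _) = adj-parts G adj in Vu , Vv

  adj-distinct : ∀ {n} (G : Graph n) {u v} → Adj G u v ≡ true → u ≢ v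
  adj-distinct G {u} adj refl
    with () ← subst (λ e → not e ≡ true) (eqᵇ-refl u) (proj₁ (proj₂ (proj₂ (adj-parts G adj))))

  adj-edge : ∀ {n} (G : Graph n) {u v} → Adj G u v ≡ true → (E G u v ∨ E G v u) ≡ true
  adj-edge G adj = proj₂ (proj₂ (proj₂ (adj-parts G adj)))

  Adj-induced : ∀ {n} (G : Graph n) (S : Fin n → Bool) u v →
    Adj (induced G S) u v ≡ Adj G u v ∧ (S u ∧ S v)
  Adj-induced G S u v =
    solve 6 (λ a s b t e f → (a :* s) :* ((b :* t) :* (e :* f)) := (a :* (b :* (e :* f))) :* (s :* t))
      refl (V G u) (S u) (V G v) (S v) (not (eqᵇ u v)) (E G u v ∨ E G v u)
    where open ∨-∧-Solver

  one-order : ∀ {n} {u v : Fin n} → u ≢ v → ind (toℕ u <ᵇ toℕ v) + ind (toℕ v <ᵇ toℕ u) ≡ 1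
  one-order {u = u} {v} u≢v with toℕ u <ᵇ toℕ v in uv | toℕ v <ᵇ toℕ u in vu
  ... | true  | false = refl
  ... | false | true  = refl
  ... | true  | true  = ⊥-elim (ℕₚ.<-asym (<ᵇ-true {toℕ u} uv) (<ᵇ-true {toℕ v} vu))
    where <ᵇ-true : ∀ {a b} → (a <ᵇ b) ≡ true → a < b
          <ᵇ-true {a} {b} e = ℕₚ.<ᵇ⇒< a b (subst T (sym e) tt)
  ... | false | false = ⊥-elim (u≢v (toℕ-injective (ℕₚ.≤-antisym (≮ {toℕ v} vu) (≮ {toℕ u} uv))))
    where ≮ : ∀ {a b} → (a <ᵇ b) ≡ false → b ≤ a
          ≮ e = ℕₚ.≮⇒≥ (λ a<b → subst T e (ℕₚ.<⇒<ᵇ a<b))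

  -- Handshake: nE counts each edge once (as u < v), ordered adjacent pairs count it twice.
  handshake : ∀ {n} (G : Graph n) → ∑∑ (λ u v → ind (Adj G u v)) ≡ 2 * nE G
  handshake G = begin
    ∑∑ (λ u v → ind (Adj G u v))
      ≡⟨ ∑∑-cong (λ u v → ind-split (lt u v) (lt v u) (Adj G u v) (λ adj → one-order (adj-distinct G adj))) ⟩
    ∑∑ (λ u v → ind (lt u v ∧ Adj G u v) + ind (lt v u ∧ Adj G u v))
      ≡⟨ ∑∑-distrib-+ (λ u v → ind (lt u v ∧ Adj G u v)) (λ u v → ind (lt v u ∧ Adj G u v)) ⟩
    A + ∑∑ (λ u v → ind (lt v u ∧ Adj G u v))
      ≡⟨ cong (A +_) (trans (∑∑-transpose (λ u v → ind (lt v u ∧ Adj G u v)))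
                            (∑∑-cong (λ v u → cong (λ e → ind (lt v u ∧ e)) (Adj-sym G u v)))) ⟩
    A + A
      ≡⟨ cong (A +_) (sym (ℕₚ.+-identityʳ A)) ⟩
    A + (A + 0)
      ≡⟨ cong (λ a → a + (a + 0)) A≡nE ⟩
    2 * nE G ∎
    where
    open ≡-Reasoning
    lt : ∀ {m} → Fin m → Fin m → Bool
    lt u v = toℕ u <ᵇ toℕ v
    A : ℕ
    A = ∑∑ (λ u v → ind (lt u v ∧ Adj G u v))
    A≡nE : A ≡ nE G
    A≡nE = sym (trans (sumF≡sum (λ u → countF (λ v → lt u v ∧ Adj G u v)))
                      (sum-cong-≗ (λ u → countF≡sum (λ v → lt u v ∧ Adj G u v))))

module Packings where

  open Booleans
  open Graphs using (Adj-induced)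
  open FiniteSums using (unique⇒length≤countF)
  open import Data.Bool using (true; _∧_; not)
  open import Data.Bool.Properties using (¬-not) renaming (_≟_ to _≟ᵇ_)
  open import Data.Nat using (zero; suc; _+_; _≤_; _<_; _≤?_; z≤n; s≤s)
  import Data.Nat.Properties as ℕₚ
  open import Data.Nat.Tactic.RingSolver using (solve-∀)
  open import Data.Nat.ListAction using (sum)
  open import Data.Nat.ListAction.Properties using (sum-++)
  open import Data.List using (List; []; _∷_; _++_; length; map; concat; filter)
  open import Data.List.Properties
    using (length-map; map-∘; map-cong; map-++; concat-map; concat-++; length-++; length-filter; filter-++)
  open import Data.List.Membership.Propositional using (_∈_)
  open import Data.List.Membership.Propositional.Properties using (∈-map⁻; ∈-++⁺ˡ; ∈-++⁺ʳ; ∈-++⁻; ∈-filter⁻)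
  open import Data.List.Relation.Unary.All as All using (All; []; _∷_)
  import Data.List.Relation.Unary.All.Properties as Allₚ
  open import Data.List.Relation.Unary.AllPairs using ([]; _∷_)
  open import Data.List.Relation.Unary.Any using (here; there)
  open import Data.List.Relation.Unary.Unique.Propositional using (Unique)
  import Data.List.Relation.Unary.Unique.Propositional.Properties as Uniqueₚ
  open import Data.List.Relation.Binary.Disjoint.Propositional using (Disjoint)
  open import Data.Product using (Σ; _×_; _,_; proj₁; proj₂; ∃-syntax)
  open import Data.Sum using (_⊎_; inj₁; inj₂)
  open import Relation.Nullary using (Dec; yes; no; ¬?)
  open import Relation.Binary.PropositionalEquality

  module _ {A : Set} where

    unique-++⁻ : ∀ (xs : List A) {ys} → Unique (xs ++ ys) → Unique xs × Unique ys × Disjoint xs ys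
    unique-++⁻ []       u = [] , u , λ ()
    unique-++⁻ (x ∷ xs) (x∉ ∷ u) =
      let (uxs , uys , disj) = unique-++⁻ xs u in
      (Allₚ.++⁻ˡ xs x∉ ∷ uxs) , uys ,
      λ { (here refl , y∈ys) → All.lookup (Allₚ.++⁻ʳ xs x∉) y∈ys refl
        ; (there y∈xs , y∈ys) → disj (y∈xs , y∈ys) }

    unique-map : ∀ {B : Set} {P : A → Set} (g : A → B) → (∀ {a b} → P a → P b → g a ≡ g b → a ≡ b) →
      ∀ {xs} → All P xs → Unique xs → Unique (map g xs)
    unique-map g inj []         []         = []
    unique-map g inj (px ∷ pxs) (x∉ ∷ u) =
      Allₚ.map⁺ (All.zipWith (λ (x≢y , py) gx≡gy → x≢y (inj px py gx≡gy)) (x∉ , pxs))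
      ∷ unique-map g inj pxs u

    length-partition : ∀ {P : A → Set} (P? : ∀ a → Dec (P a)) xs →
      length (filter P? xs) + length (filter (λ a → ¬? (P? a)) xs) ≡ length xs
    length-partition P? [] = refl
    length-partition P? (x ∷ xs) with P? x
    ... | yes px = cong suc (length-partition P? xs)
    ... | no ¬px = trans (ℕₚ.+-suc _ _) (cong suc (length-partition P? xs))

  packing-vertices : ∀ {n} {G : Graph n} (P : CliquePacking G) → All (λ v → V G v ≡ true) (concat (CliquePacking.comps P))
  packing-vertices P = Allₚ.concat⁺ (All.map (λ k → proj₁ (proj₂ k)) (CliquePacking.isClique P))

  weight : ∀ {n} → List (Fin n) → ℕ
  weight c = weightK (length c)

  module _ {m n} {H : Graph m} {G : Graph n} (g : Fin m → Fin n)
           (g-vertex : ∀ a → V H a ≡ true → V G (g a) ≡ true)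
           (g-edge : ∀ a b → Adj H a b ≡ true → Adj G (g a) (g b) ≡ true)
           (g-inj : ∀ {a b} → V H a ≡ true → V H b ≡ true → g a ≡ g b → a ≡ b) where

    clique-map : ∀ {c} → IsK3orK4 H c → IsK3orK4 G (map g c)
    clique-map {c} (size , vertices , adjacent) =
      subst (λ l → l ≡ 3 ⊎ l ≡ 4) (sym (length-map g c)) size ,
      Allₚ.map⁺ (All.map (g-vertex _) vertices) ,
      λ x y x∈ y∈ x≢y → image-adjacent (∈-map⁻ g x∈) (∈-map⁻ g y∈) x≢y
      where
      image-adjacent : ∀ {x y} → ∃[ a ] (a ∈ c × x ≡ g a) → ∃[ b ] (b ∈ c × y ≡ g b) →
        x ≢ y → Adj G x y ≡ true
      image-adjacent (a , a∈ , refl) (b , b∈ , refl) ga≢gb =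
        g-edge a b (adjacent a b a∈ b∈ (λ a≡b → ga≢gb (cong g a≡b)))

    packing-map : (P : CliquePacking H) → Σ (CliquePacking G) λ Q → packValue Q ≡ packValue P
    packing-map P = Q , value
      where
      open CliquePacking P
      Q : CliquePacking G
      Q = record
        { comps    = map (map g) comps
        ; isClique = Allₚ.map⁺ (All.map clique-map isClique)
        ; disjoint = subst Unique (sym (concat-map comps))
            (unique-map g g-inj (packing-vertices P) disjoint)
        }
      value : packValue Q ≡ packValue P
      value = cong sum (trans (sym (map-∘ comps)) (map-cong (λ c → cong weightK (length-map g c)) comps))

    packing-map-covers : ∀ {Pr : Fin n → Set} (P : CliquePacking H) →
      All (λ a → Pr (g a)) (concat (CliquePacking.comps P)) →
      All Pr (concat (CliquePacking.comps (proj₁ (packing-map P))))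
    packing-map-covers P covers = subst (All _) (sym (concat-map (CliquePacking.comps P))) (Allₚ.map⁺ covers)

  packing-union : ∀ {n} {G : Graph n} (P Q : CliquePacking G) →
    Disjoint (concat (CliquePacking.comps P)) (concat (CliquePacking.comps Q)) →
    Σ (CliquePacking G) λ PQ → packValue PQ ≡ packValue P + packValue Q
  packing-union {G = G} P Q disj = PQ , value
    where
    module P = CliquePacking P
    module Q = CliquePacking Q
    PQ : CliquePacking G
    PQ = record
      { comps    = P.comps ++ Q.comps
      ; isClique = Allₚ.++⁺ P.isClique Q.isClique
      ; disjoint = subst Unique (concat-++ P.comps Q.comps) (Uniqueₚ.++⁺ P.disjoint Q.disjoint disj)
      }
    value : packValue PQ ≡ packValue P + packValue Q
    value = trans (cong sum (map-++ weight P.comps Q.comps)) (sum-++ (map weight P.comps) _)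

  private
    weightK≤2 : ∀ x → weightK x ≤ 2
    weightK≤2 0 = z≤n
    weightK≤2 1 = z≤n
    weightK≤2 2 = z≤n
    weightK≤2 3 = s≤s z≤n
    weightK≤2 4 = ℕₚ.≤-refl
    weightK≤2 (suc (suc (suc (suc (suc x))))) = z≤n

    weightK-small : ∀ x → x < 3 → weightK x ≡ 0
    weightK-small 0 _ = refl
    weightK-small 1 _ = refl
    weightK-small 2 _ = refl
    weightK-small (suc (suc (suc x))) (s≤s (s≤s (s≤s ())))

    weightK-lose-one : ∀ o → weightK (o + 1) ≤ weightK o + 1
    weightK-lose-one 0 = z≤n
    weightK-lose-one 1 = z≤n
    weightK-lose-one 2 = ℕₚ.≤-refl
    weightK-lose-one 3 = ℕₚ.≤-refl
    weightK-lose-one 4 = z≤n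
    weightK-lose-one (suc (suc (suc (suc (suc o))))) = z≤n

  weightK-lose : ∀ o w → weightK (o + w) ≤ weightK o + w
  weightK-lose o zero          =
    ℕₚ.≤-reflexive (trans (cong weightK (ℕₚ.+-identityʳ o)) (sym (ℕₚ.+-identityʳ (weightK o))))
  weightK-lose o (suc zero)    = weightK-lose-one o
  weightK-lose o (suc (suc w)) =
    ℕₚ.≤-trans (weightK≤2 (o + suc (suc w))) (ℕₚ.≤-trans (s≤s (s≤s z≤n)) (ℕₚ.m≤n+m (suc (suc w)) (weightK o)))

  three-or-four : ∀ {x} → 3 ≤ x → x ≤ 4 → x ≡ 3 ⊎ x ≡ 4
  three-or-four {0} ()
  three-or-four {1} (s≤s ())
  three-or-four {2} (s≤s (s≤s ()))
  three-or-four {3} _ _ = inj₁ refl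
  three-or-four {4} _ _ = inj₂ refl
  three-or-four {suc (suc (suc (suc (suc x))))} _ (s≤s (s≤s (s≤s (s≤s ()))))

  size≤4 : ∀ {x} → x ≡ 3 ⊎ x ≡ 4 → x ≤ 4
  size≤4 (inj₁ refl) = s≤s (s≤s (s≤s z≤n))
  size≤4 (inj₂ refl) = ℕₚ.≤-refl

  module Restriction {m} (H : Graph m) (S : Fin m → Bool) where

    inS? : ∀ a → Dec (S a ≡ true)
    inS? a = S a ≟ᵇ true

    inside outside : List (Fin m) → List (Fin m)
    inside  = filter inS?
    outside = filter (λ a → ¬? (inS? a))

    restrict : List (List (Fin m)) → List (List (Fin m))
    restrict [] = []
    restrict (c ∷ cs) with 3 ≤? length (inside c)
    ... | yes _ = inside c ∷ restrict cs
    ... | no  _ = restrict cs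

    ∈-restrict : ∀ cs {a} → a ∈ concat (restrict cs) → a ∈ concat cs
    ∈-restrict (c ∷ cs) a∈ with 3 ≤? length (inside c)
    ... | no  _ = ∈-++⁺ʳ c (∈-restrict cs a∈)
    ... | yes _ with ∈-++⁻ (inside c) a∈
    ...   | inj₁ a∈c = ∈-++⁺ˡ (proj₁ (∈-filter⁻ inS? {xs = c} a∈c))
    ...   | inj₂ a∈r = ∈-++⁺ʳ c (∈-restrict cs a∈r)

    restrict-unique : ∀ cs → Unique (concat cs) → Unique (concat (restrict cs))
    restrict-unique []       u = u
    restrict-unique (c ∷ cs) u with unique-++⁻ c u | 3 ≤? length (inside c)
    ... | _ , ucs , _ | no _ = restrict-unique cs ucs
    ... | uc , ucs , disj | yes _ =
      Uniqueₚ.++⁺ (Uniqueₚ.filter⁺ inS? uc) (restrict-unique cs ucs)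
        (λ (a∈c , a∈r) → disj (proj₁ (∈-filter⁻ inS? {xs = c} a∈c) , ∈-restrict cs a∈r))

    restrict-clique : ∀ {c} → IsK3orK4 H c → 3 ≤ length (inside c) → IsK3orK4 (induced H S) (inside c)
    restrict-clique {c} (size , vertices , adjacent) big =
      three-or-four big (ℕₚ.≤-trans (length-filter inS? c) (size≤4 size)) ,
      All.tabulate (λ a∈ → let (a∈c , Sa) = ∈-filter⁻ inS? {xs = c} a∈ in cong₂ _∧_ (All.lookup vertices a∈c) Sa) ,
      λ a b a∈ b∈ a≢b →
        let (a∈c , Sa) = ∈-filter⁻ inS? {xs = c} a∈ ; (b∈c , Sb) = ∈-filter⁻ inS? {xs = c} b∈ in
        trans (Adj-induced H S a b) (cong₂ _∧_ (adjacent a b a∈c b∈c a≢b) (cong₂ _∧_ Sa Sb))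

    restrict-cliques : ∀ {cs} → All (IsK3orK4 H) cs → All (IsK3orK4 (induced H S)) (restrict cs)
    restrict-cliques {[]}     []         = []
    restrict-cliques {c ∷ cs} (k ∷ ks) with 3 ≤? length (inside c)
    ... | yes big = restrict-clique k big ∷ restrict-cliques ks
    ... | no  _   = restrict-cliques ks

    restrict-cons : ∀ c cs →
      sum (map weight (restrict (c ∷ cs))) ≡ weight (inside c) + sum (map weight (restrict cs))
    restrict-cons c cs with 3 ≤? length (inside c)
    ... | yes _     = refl
    ... | no  small = cong (_+ sum (map weight (restrict cs)))
                           (sym (weightK-small _ (ℕₚ.≰⇒> small)))

    -- Each clique loses at most one unit of value per vertex outside S.
    restrict-value : ∀ cs →
      sum (map weight cs) ≤ sum (map weight (restrict cs)) + length (outside (concat cs))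
    restrict-value []       = z≤n
    restrict-value (c ∷ cs) = begin
      weight c + sum (map weight cs)
        ≤⟨ ℕₚ.+-mono-≤ clique-loss (restrict-value cs) ⟩
      (weight (inside c) + length (outside c)) + (sum (map weight (restrict cs)) + length (outside (concat cs)))
        ≡⟨ interchange (weight (inside c)) (length (outside c)) (sum (map weight (restrict cs))) _ ⟩
      (weight (inside c) + sum (map weight (restrict cs))) + (length (outside c) + length (outside (concat cs)))
        ≡⟨ cong₂ _+_ (sym (restrict-cons c cs))
             (sym (trans (cong length (filter-++ (λ a → ¬? (inS? a)) c (concat cs))) (length-++ (outside c)))) ⟩
      sum (map weight (restrict (c ∷ cs))) + length (outside (c ++ concat cs)) ∎
      where
      open ℕₚ.≤-Reasoning
      clique-loss : weight c ≤ weight (inside c) + length (outside c)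
      clique-loss = subst (λ l → weightK l ≤ weight (inside c) + length (outside c))
                          (length-partition inS? c) (weightK-lose (length (inside c)) (length (outside c)))
      interchange : ∀ a b c d → (a + b) + (c + d) ≡ (a + c) + (b + d)
      interchange = solve-∀

    packing-restrict : (P : CliquePacking H) →
      Σ (CliquePacking (induced H S)) λ Q → packValue P ≤ packValue Q + countF (λ a → V H a ∧ not (S a))
    packing-restrict P = Q , ℕₚ.≤-trans (restrict-value comps) (ℕₚ.+-monoʳ-≤ (packValue Q) deleted≤)
      where
      open CliquePacking P
      Q : CliquePacking (induced H S)
      Q = record { comps = restrict comps ; isClique = restrict-cliques isClique
                 ; disjoint = restrict-unique comps disjoint }
      deleted≤ : length (outside (concat comps)) ≤ countF (λ a → V H a ∧ not (S a))
      deleted≤ = unique⇒length≤countF _ (Uniqueₚ.filter⁺ _ disjoint)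
        (All.tabulate (λ a∈ → let (a∈cs , ¬Sa) = ∈-filter⁻ (λ a → ¬? (inS? a)) {xs = concat comps} a∈ in
          cong₂ _∧_ (All.lookup (packing-vertices P) a∈cs) (cong not (¬-not ¬Sa))))

  T-restrict : ∀ {m} (H : Graph m) (S : Fin m → Bool) {t t′} →
    IsT H t → IsT (induced H S) t′ → t ≤ t′ + countF (λ a → V H a ∧ not (S a))
  T-restrict H S ((P , refl) , _) (_ , maximal) =
    let (Q , lost) = Restriction.packing-restrict H S P in
    ℕₚ.≤-trans lost (ℕₚ.+-monoˡ-≤ _ (maximal Q))

module Extension {n : ℕ} (G : Graph n) (R : Fin n → Bool) (φ : Fin n → Fin 4)
                 (W : Graph (n ℕ.+ 4)) (W⊆Gφ : W ⊆G Gφ G R φ) where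

  open Booleans
  open FiniteSums
  open Graphs
  open Packings using (packing-map; packing-map-covers; packing-union; packing-vertices; T-restrict)
  open import Data.Bool using (true; false; _∧_; _∨_; not)
  open import Data.Bool.Properties using (∧-identityʳ; ∧-zeroʳ; ∧-comm; ∨-identityʳ; ∨-zeroʳ; not-involutive)
  open import Data.Nat using (_+_; _*_; _≤_; z≤n)
  import Data.Nat.Properties as ℕₚ
  open import Data.Nat.Combinatorics using (_C_)
  open import Data.Nat.Tactic.RingSolver using (solve-∀)
  import Data.Fin as Fin
  open import Data.Fin using (_↑ˡ_; _↑ʳ_; splitAt)
  import Data.Fin.Properties as Finₚ
  open import Data.List using (concat)
  open import Data.List.Relation.Unary.All as All using (All)
  open import Data.List.Relation.Binary.Disjoint.Propositional using (Disjoint)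
  open import Data.Product using (Σ; _×_; _,_; proj₁; proj₂)
  open import Data.Sum using (_⊎_; inj₁; inj₂; [_,_]′)
  open import Function using (case_of_)
  open import Relation.Binary.PropositionalEquality

  old : Fin n → Fin (n + 4)
  old v = v ↑ˡ 4

  new : Fin 4 → Fin (n + 4)
  new j = n ↑ʳ j

  old-or-new : ∀ a → (Σ (Fin n) λ u → old u ≡ a) ⊎ (Σ (Fin 4) λ j → new j ≡ a)
  old-or-new a with splitAt n a in e
  ... | inj₁ u = inj₁ (u , Finₚ.splitAt⁻¹-↑ˡ e)
  ... | inj₂ j = inj₂ (j , Finₚ.splitAt⁻¹-↑ʳ e)

  O : Fin n → Bool
  O v = V W (old v)

  X : Fin 4 → Bool
  X j = V W (new j)

  R' : Fin n → Bool
  R' = extension R W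

  k : ℕ
  k = coreSize W

  toColour : Fin n → Fin 4 → Bool
  toColour u j = anyF (λ w → R w ∧ eqᵇ (φ w) j ∧ Adj G u w)

  private
    module Gφ = Graph (Gφ G R φ)

    V-old : ∀ v → Gφ.V (old v) ≡ V G v ∧ not (R v)
    V-old v rewrite Finₚ.splitAt-↑ˡ n v 4 = refl

    E-old-old : ∀ u v → Gφ.E (old u) (old v) ≡ Adj G u v
    E-old-old u v rewrite Finₚ.splitAt-↑ˡ n u 4 | Finₚ.splitAt-↑ˡ n v 4 = refl

    E-old-new : ∀ u j → Gφ.E (old u) (new j) ≡ toColour u j
    E-old-new u j rewrite Finₚ.splitAt-↑ˡ n u 4 | Finₚ.splitAt-↑ʳ n 4 j = refl

    E-new-old : ∀ u j → Gφ.E (new j) (old u) ≡ toColour u j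
    E-new-old u j rewrite Finₚ.splitAt-↑ˡ n u 4 | Finₚ.splitAt-↑ʳ n 4 j = refl

    isOld-old : ∀ v → isOld {n} (old v) ≡ true
    isOld-old v rewrite Finₚ.splitAt-↑ˡ n v 4 = refl

    isOld-new : ∀ j → isOld {n} (new j) ≡ false
    isOld-new j rewrite Finₚ.splitAt-↑ʳ n 4 j = refl

    W-edge : ∀ {a b} → Adj W a b ≡ true → (Gφ.E a b ∨ Gφ.E b a) ≡ true
    W-edge adj = adj-edge (Gφ G R φ) (proj₂ W⊆Gφ _ _ adj)

  old-vertex : ∀ {v} → O v ≡ true → V G v ≡ true × R v ≡ false
  old-vertex {v} Ov =
    let (VGv , ¬Rv) = ∧-elim {V G v} (trans (sym (V-old v)) (proj₁ W⊆Gφ _ Ov)) in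
    VGv , trans (sym (not-involutive (R v))) (cong not ¬Rv)

  old-edge : ∀ u v → Adj W (old u) (old v) ≡ true → Adj G u v ≡ true
  old-edge u v adj with ∨-elim (subst₂ (λ x y → (x ∨ y) ≡ true) (E-old-old u v) (E-old-old v u) (W-edge adj))
  ... | inj₁ uv = uv
  ... | inj₂ vu = trans (Adj-sym G u v) vu

  cross-edge : ∀ u j → Adj W (old u) (new j) ≡ true → toColour u j ≡ true
  cross-edge u j adj with ∨-elim (subst₂ (λ x y → (x ∨ y) ≡ true) (E-old-new u j) (E-new-old u j) (W-edge adj))
  ... | inj₁ e = e
  ... | inj₂ e = e

  core-size : k ≡ sum (λ j → ind (X j))
  core-size = begin
    k ≡⟨ countF≡sum (λ a → V W a ∧ not (isOld a)) ⟩
    sum (λ a → ind (V W a ∧ not (isOld a)))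
      ≡⟨ ∑-splitAt n 4 (λ a → ind (V W a ∧ not (isOld a))) ⟩
    sum (λ i → ind (O i ∧ not (isOld (old i)))) + sum (λ j → ind (X j ∧ not (isOld (new j))))
      ≡⟨ cong₂ _+_
           (∑-zero (λ i → cong ind (trans (cong (λ b → O i ∧ not b) (isOld-old i)) (∧-zeroʳ (O i)))))
           (sum-cong-≗ (λ j → cong ind (trans (cong (λ b → X j ∧ not b) (isOld-new j)) (∧-identityʳ (X j))))) ⟩
    sum (λ j → ind (X j)) ∎
    where open ≡-Reasoning

  vertex-count : nV (induced G R') + k ≡ nV (induced G R) + nV W
  vertex-count = begin
    nV (induced G R') + k
      ≡⟨ cong₂ _+_ (trans (countF≡sum (λ v → V G v ∧ R' v))
                     (trans (sum-cong-≗ inside-or-new) (∑-distrib-+ (λ v → ind (V G v ∧ R v)) (λ v → ind (O v))))) core-size ⟩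
    (sum (λ v → ind (V G v ∧ R v)) + sum (λ v → ind (O v))) + sum (λ j → ind (X j))
      ≡⟨ ℕₚ.+-assoc (sum (λ v → ind (V G v ∧ R v))) _ _ ⟩
    sum (λ v → ind (V G v ∧ R v)) + (sum (λ v → ind (O v)) + sum (λ j → ind (X j)))
      ≡⟨ cong₂ _+_ (sym (countF≡sum (λ v → V G v ∧ R v)))
                   (sym (trans (countF≡sum (V W)) (∑-splitAt n 4 (λ a → ind (V W a))))) ⟩
    nV (induced G R) + nV W ∎
    where
    open ≡-Reasoning
    inside-or-new : ∀ v → ind (V G v ∧ (R v ∨ O v)) ≡ ind (V G v ∧ R v) + ind (O v)
    inside-or-new v with O v in Ov
    ... | true  = let (VGv , ¬Rv) = old-vertex Ov in
                  subst₂ (λ a r → ind (a ∧ (r ∨ true)) ≡ ind (a ∧ r) + 1) (sym VGv) (sym ¬Rv) refl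
    ... | false = trans (cong (λ b → ind (V G v ∧ b)) (∨-identityʳ (R v)))
                        (sym (ℕₚ.+-identityʳ _))

  core≤4 : k ≤ 4
  core≤4 = subst (_≤ 4) (sym core-size) (∑-mono (λ j → ind≤1 (X j)))

  colour-without-core : (∀ j → X j ≡ false) → Colouring 4 (induced G O) → Colouring 4 W
  colour-without-core no-core (c , c-proper) = colour , proper
    where
    colour : Fin (n + 4) → Fin 4
    colour a = [ c , (λ _ → Fin.zero) ]′ (splitAt n a)

    colour-old : ∀ u → colour (old u) ≡ c u
    colour-old u = cong [ c , (λ _ → Fin.zero) ]′ (Finₚ.splitAt-↑ˡ n u 4)

    proper : ∀ a b → Adj W a b ≡ true → colour a ≢ colour b
    proper a b adj with old-or-new a | old-or-new b
    ... | inj₂ (j , refl) | _ with () ← trans (sym (no-core j)) (proj₁ (adj-ends W adj))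
    ... | inj₁ _ | inj₂ (j , refl) with () ← trans (sym (no-core j)) (proj₂ (adj-ends W adj))
    ... | inj₁ (u , refl) | inj₁ (v , refl) =
      subst₂ _≢_ (sym (colour-old u)) (sym (colour-old v))
        (c-proper u v (trans (Adj-induced G O u v)
          (cong₂ _∧_ (old-edge u v adj) (cong₂ _∧_ (proj₁ (adj-ends W adj)) (proj₂ (adj-ends W adj))))))

  -- The core is nonempty: otherwise the proper subgraph G[R' ∖ R] of G (it misses v₀ ∈ R)
  -- would be 4-colourable, and so would W.
  core-nonempty : Critical5 G → Critical5 W → ∀ {v₀} → V G v₀ ≡ true → R v₀ ≡ true → 1 ≤ k
  core-nonempty (_ , G-minimal) (W-uncolourable , _) {v₀} VGv₀ Rv₀ =
    ℕₚ.n≢0⇒n>0 (λ k≡0 → W-uncolourable (colour-without-core (empty-core k≡0) (G-minimal (induced G O) O⊂G)))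
    where
    empty-core : k ≡ 0 → ∀ j → X j ≡ false
    empty-core k≡0 j with X j in Xj
    ... | false = refl
    ... | true  with () ← subst₂ _≤_ (cong ind Xj) (trans (sym core-size) k≡0) (term≤∑ (λ i → ind (X i)) j)

    v₀∉O : V (induced G O) v₀ ≡ false
    v₀∉O with O v₀ in Ov₀
    ... | false = ∧-zeroʳ (V G v₀)
    ... | true  with () ← trans (sym Rv₀) (proj₂ (old-vertex Ov₀))

    O⊂G : induced G O ⊂G G
    O⊂G = ((λ v Ov → proj₁ (∧-elim {V G v} Ov)) ,
           (λ u v adj → proj₁ (∧-elim {Adj G u v} (trans (sym (Adj-induced G O u v)) adj)))) ,
          inj₁ (v₀ , VGv₀ , v₀∉O)

  pair : (Fin n → Bool) → (Fin n → Bool) → Fin n → Fin n → ℕ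
  pair S T u v = ind (Adj G u v ∧ (S u ∧ T v))

  pairs : (Fin n → Bool) → (Fin n → Bool) → ℕ
  pairs S T = ∑∑ (pair S T)

  pairs-induced : ∀ S → 2 * nE (induced G S) ≡ pairs S S
  pairs-induced S = trans (sym (handshake (induced G S))) (∑∑-cong (λ u v → cong ind (Adj-induced G S u v)))

  pairs-sym : ∀ S T → pairs T S ≡ pairs S T
  pairs-sym S T = trans (∑∑-transpose (pair T S))
    (∑∑-cong (λ v u → cong ind (cong₂ _∧_ (Adj-sym G u v) (∧-comm (T u) (S v)))))

  -- R' is the disjoint union of R and R' ∖ R.
  pairs-extension : pairs R' R' ≡ pairs R R + pairs O O + pairs O R + pairs R O
  pairs-extension = begin
    pairs R' R'
      ≡⟨ ∑∑-cong (λ u v → ind-expand (Adj G u v) (λ Ou → proj₂ (old-vertex Ou)) (λ Ov → proj₂ (old-vertex Ov))) ⟩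
    ∑∑ (λ u v → pair R R u v + pair O O u v + pair O R u v + pair R O u v)
      ≡⟨ ∑∑-distrib-+ (λ u v → pair R R u v + pair O O u v + pair O R u v) (pair R O) ⟩
    ∑∑ (λ u v → pair R R u v + pair O O u v + pair O R u v) + pairs R O
      ≡⟨ cong (_+ pairs R O) (∑∑-distrib-+ (λ u v → pair R R u v + pair O O u v) (pair O R)) ⟩
    ∑∑ (λ u v → pair R R u v + pair O O u v) + pairs O R + pairs R O
      ≡⟨ cong (λ x → x + pairs O R + pairs R O) (∑∑-distrib-+ (pair R R) (pair O O)) ⟩
    pairs R R + pairs O O + pairs O R + pairs R O ∎
    where open ≡-Reasoning

  OO NO ON NN : ℕ
  OO = ∑∑ (λ u v → ind (Adj W (old u) (old v)))
  NO = ∑∑ (λ j v → ind (Adj W (new j) (old v)))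
  ON = ∑∑ (λ u j → ind (Adj W (old u) (new j)))
  NN = ∑∑ (λ i j → ind (Adj W (new i) (new j)))

  W-pairs : 2 * nE W ≡ (OO + NO) + (ON + NN)
  W-pairs = begin
    2 * nE W
      ≡⟨ sym (handshake W) ⟩
    ∑∑ (λ a b → ind (Adj W a b))
      ≡⟨ sum-cong-≗ (λ a → ∑-splitAt n 4 (λ b → ind (Adj W a b))) ⟩
    sum (λ a → sum (λ v → ind (Adj W a (old v))) + sum (λ j → ind (Adj W a (new j))))
      ≡⟨ ∑-distrib-+ (λ a → sum (λ v → ind (Adj W a (old v)))) (λ a → sum (λ j → ind (Adj W a (new j)))) ⟩
    sum (λ a → sum (λ v → ind (Adj W a (old v)))) + sum (λ a → sum (λ j → ind (Adj W a (new j))))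
      ≡⟨ cong₂ _+_ (∑-splitAt n 4 (λ a → sum (λ v → ind (Adj W a (old v)))))
                   (∑-splitAt n 4 (λ a → sum (λ j → ind (Adj W a (new j))))) ⟩
    (OO + NO) + (ON + NN) ∎
    where open ≡-Reasoning

  OO≤ : OO ≤ pairs O O
  OO≤ = ∑∑-mono (λ u v → ind-mono {Adj W (old u) (old v)} (λ adj →
    cong₂ _∧_ (old-edge u v adj) (cong₂ _∧_ (proj₁ (adj-ends W adj)) (proj₂ (adj-ends W adj)))))

  NO≡ON : NO ≡ ON
  NO≡ON = trans (∑∑-transpose (λ j v → ind (Adj W (new j) (old v))))
                (∑∑-cong (λ u j → cong ind (Adj-sym W (new j) (old u))))

  -- An old vertex u is adjacent in W to at most as many core vertices as it has neighbours in R: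
  -- an edge u x_j needs a neighbour of u in R of colour j, and every vertex has one colour.
  ON≤ : ON ≤ pairs O R
  ON≤ = ∑-mono (λ u → ℕₚ.≤-trans
    (∑-mono (λ j → ind-mono {Adj W (old u) (new j)} {O u ∧ toColour u j}
                     (λ adj → cong₂ _∧_ (proj₁ (adj-ends W adj)) (cross-edge u j adj))))
    (colour-classes u (O u)))
    where
    one-colour : ∀ r (c : Fin 4) b → sum (λ j → ind (r ∧ (eqᵇ c j ∧ b))) ≡ ind (r ∧ b)
    one-colour true  c b = ∑-one-hot c b
    one-colour false c b = refl

    colour-classes : ∀ u b → sum (λ j → ind (b ∧ toColour u j)) ≤ sum (λ v → pair (λ _ → b) R u v)
    colour-classes u false = z≤n
    colour-classes u true  = begin
      sum (λ j → ind (toColour u j))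
        ≤⟨ ∑-mono (λ j → anyF≤count (λ w → R w ∧ eqᵇ (φ w) j ∧ Adj G u w)) ⟩
      ∑∑ (λ j w → ind (R w ∧ eqᵇ (φ w) j ∧ Adj G u w))
        ≡⟨ ∑∑-transpose (λ j w → ind (R w ∧ eqᵇ (φ w) j ∧ Adj G u w)) ⟩
      ∑∑ (λ w j → ind (R w ∧ eqᵇ (φ w) j ∧ Adj G u w))
        ≡⟨ sum-cong-≗ (λ w → trans (one-colour (R w) (φ w) (Adj G u w)) (cong ind (∧-comm (R w) (Adj G u w)))) ⟩
      sum (λ v → ind (Adj G u v ∧ R v)) ∎
      where open ℕₚ.≤-Reasoning

  NN≤ : NN ≤ 2 * (k C 2)
  NN≤ = begin
    NN
      ≤⟨ ∑∑-mono (λ i j → ind-mono (core-pair i j)) ⟩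
    ∑∑ (λ i j → ind (not (eqᵇ i j) ∧ (X i ∧ X j)))
      ≡⟨ ordered-pairs X ⟩
    2 * (countF X C 2)
      ≡⟨ cong (λ x → 2 * (x C 2)) (trans (countF≡sum X) (sym core-size)) ⟩
    2 * (k C 2) ∎
    where
    open ℕₚ.≤-Reasoning
    core-pair : ∀ i j → Adj W (new i) (new j) ≡ true → not (eqᵇ i j) ∧ (X i ∧ X j) ≡ true
    core-pair i j adj = cong₂ _∧_ (cong not (eqᵇ-≢ (λ i≡j → adj-distinct W adj (cong new i≡j))))
                                  (cong₂ _∧_ (proj₁ (adj-ends W adj)) (proj₂ (adj-ends W adj)))

  edge-count : nE (induced G R) + nE W ≤ nE (induced G R') + k C 2
  edge-count = ℕₚ.*-cancelˡ-≤ 2 (begin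
    2 * (nE (induced G R) + nE W)
      ≡⟨ ℕₚ.*-distribˡ-+ 2 (nE (induced G R)) (nE W) ⟩
    2 * nE (induced G R) + 2 * nE W
      ≡⟨ cong₂ _+_ (pairs-induced R) W-pairs ⟩
    pairs R R + ((OO + NO) + (ON + NN))
      ≤⟨ ℕₚ.+-monoʳ-≤ (pairs R R) (ℕₚ.+-mono-≤ (ℕₚ.+-mono-≤ OO≤ (subst (_≤ pairs O R) (sym NO≡ON) ON≤))
                                               (ℕₚ.+-mono-≤ ON≤ NN≤)) ⟩
    pairs R R + ((pairs O O + pairs O R) + (pairs O R + 2 * (k C 2)))
      ≡⟨ regroup (pairs R R) (pairs O O) (pairs O R) (2 * (k C 2)) ⟩
    (pairs R R + pairs O O + pairs O R + pairs O R) + 2 * (k C 2)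
      ≡⟨ cong (λ x → (pairs R R + pairs O O + pairs O R + x) + 2 * (k C 2)) (sym (pairs-sym O R)) ⟩
    (pairs R R + pairs O O + pairs O R + pairs R O) + 2 * (k C 2)
      ≡⟨ cong (_+ 2 * (k C 2)) (sym (trans (pairs-induced R') pairs-extension)) ⟩
    2 * nE (induced G R') + 2 * (k C 2)
      ≡⟨ sym (ℕₚ.*-distribˡ-+ 2 (nE (induced G R')) (k C 2)) ⟩
    2 * (nE (induced G R') + k C 2) ∎)
    where
    open ℕₚ.≤-Reasoning
    regroup : ∀ a b c d → a + ((b + c) + (c + d)) ≡ (a + b + c + c) + d
    regroup = solve-∀

  O⊆R' : ∀ {v} → O v ≡ true → V (induced G R') v ≡ true
  O⊆R' {v} Ov = cong₂ _∧_ (proj₁ (old-vertex Ov)) (trans (cong (R v ∨_) Ov) (∨-zeroʳ (R v)))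

  packing-from-R : (P : CliquePacking (induced G R)) → Σ (CliquePacking (induced G R')) λ P′ →
    packValue P′ ≡ packValue P × All (λ v → R v ≡ true) (concat (CliquePacking.comps P′))
  packing-from-R P =
    proj₁ moved , proj₂ moved ,
    packing-map-covers {G = induced G R'} (λ v → v) R-vertex R-edge (λ _ _ e → e) P
      (All.map (λ {v} VRv → proj₂ (∧-elim {V G v} VRv)) (packing-vertices P))
    where
    R-vertex : ∀ v → V (induced G R) v ≡ true → V (induced G R') v ≡ true
    R-vertex v VRv = let (VGv , Rv) = ∧-elim {V G v} VRv in cong₂ _∧_ VGv (cong (_∨ O v) Rv)

    R-edge : ∀ u v → Adj (induced G R) u v ≡ true → Adj (induced G R') u v ≡ true
    R-edge u v adj =
      let (Guv , RuRv) = ∧-elim {Adj G u v} (trans (sym (Adj-induced G R u v)) adj)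
          (Ru , Rv) = ∧-elim {R u} RuRv in
      trans (Adj-induced G R' u v) (cong₂ _∧_ Guv (cong₂ _∧_ (cong (_∨ O u) Ru) (cong (_∨ O v) Rv)))

    moved : Σ (CliquePacking (induced G R')) λ P′ → packValue P′ ≡ packValue P
    moved = packing-map (λ v → v) R-vertex R-edge (λ _ _ e → e) P

  -- Moving W ∖ X back onto V(G) turns a packing of W ∖ X into a packing of G[R'] covering only
  -- vertices of R' ∖ R.  The default vertex d is only used for new vertices, which W ∖ X lacks.
  packing-from-W : Fin n → (Q : CliquePacking (minusCore W)) → Σ (CliquePacking (induced G R')) λ Q′ →
    packValue Q′ ≡ packValue Q × All (λ v → O v ≡ true) (concat (CliquePacking.comps Q′))
  packing-from-W d Q =
    proj₁ moved , proj₂ moved ,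
    packing-map-covers {G = induced G R'} back back-vertex′ back-edge back-injective Q (All.map (back-vertex _) (packing-vertices Q))
    where
    back : Fin (n + 4) → Fin n
    back a = [ (λ u → u) , (λ _ → d) ]′ (splitAt n a)

    back-old : ∀ a → isOld a ≡ true → old (back a) ≡ a
    back-old a isOld-a with splitAt n a in e
    ... | inj₁ u = Finₚ.splitAt⁻¹-↑ˡ e

    back-vertex : ∀ a → V (minusCore W) a ≡ true → O (back a) ≡ true
    back-vertex a Va = let (Wa , old-a) = ∧-elim {V W a} Va in trans (cong (V W) (back-old a old-a)) Wa

    back-vertex′ : ∀ a → V (minusCore W) a ≡ true → V (induced G R') (back a) ≡ true
    back-vertex′ a Va = O⊆R' (back-vertex a Va)

    back-edge : ∀ a b → Adj (minusCore W) a b ≡ true → Adj (induced G R') (back a) (back b) ≡ true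
    back-edge a b adj =
      let (Wab , olds) = ∧-elim {Adj W a b} (trans (sym (Adj-induced W isOld a b)) adj)
          (old-a , old-b) = ∧-elim {isOld a} olds
          Wab′ = subst₂ (λ x y → Adj W x y ≡ true) (sym (back-old a old-a)) (sym (back-old b old-b)) Wab
          (Oa , Ob) = adj-ends W Wab′ in
      trans (Adj-induced G R' (back a) (back b))
            (cong₂ _∧_ (old-edge (back a) (back b) Wab′)
                       (cong₂ _∧_ (proj₂ (∧-elim {V G (back a)} (O⊆R' Oa))) (proj₂ (∧-elim {V G (back b)} (O⊆R' Ob)))))

    back-injective : ∀ {a b} → V (minusCore W) a ≡ true → V (minusCore W) b ≡ true → back a ≡ back b → a ≡ b
    back-injective {a} {b} Va Vb e =
      trans (sym (back-old a (proj₂ (∧-elim {V W a} Va)))) (trans (cong old e) (back-old b (proj₂ (∧-elim {V W b} Vb))))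

    moved : Σ (CliquePacking (induced G R')) λ Q′ → packValue Q′ ≡ packValue Q
    moved = packing-map back back-vertex′ back-edge back-injective Q

  -- The two moved packings live on the disjoint sets R and R' ∖ R, so together they form a
  -- packing of G[R'].
  T-grow : Fin n → ∀ {tR tWX tR'} →
    IsT (induced G R) tR → IsT (minusCore W) tWX → IsT (induced G R') tR' → tR + tWX ≤ tR'
  T-grow d ((P , refl) , _) ((Q , refl) , _) (_ , maximal) =
    let (P′ , P′-value , P′⊆R) = packing-from-R P
        (Q′ , Q′-value , Q′⊆O) = packing-from-W d Q
        disjoint : Disjoint (concat (CliquePacking.comps P′)) (concat (CliquePacking.comps Q′))
        disjoint = λ (v∈P′ , v∈Q′) →
          case trans (sym (All.lookup P′⊆R v∈P′)) (proj₂ (old-vertex (All.lookup Q′⊆O v∈Q′))) of λ ()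
        (PQ , PQ-value) = packing-union P′ Q′ disjoint in
    subst (_≤ _) (trans PQ-value (cong₂ _+_ P′-value Q′-value)) (maximal PQ)

  T-core : ∀ {tW tWX} → IsT W tW → IsT (minusCore W) tWX → tW ≤ tWX + k
  T-core = T-restrict W isOld

module Potential where

  open import Data.Nat.Combinatorics using (_C_)
  import Data.Nat.Properties as ℕₚ
  import Data.Nat.Coprimality as Coprimality
  open import Data.Integer as ℤ using (+_)
  import Data.Integer.Properties as ℤₚ
  open import Data.Product using (_,_)
  open import Data.Rational using (ℚ; mkℚ; 0ℚ; _/_; _+_; _-_; _*_; _≤_; _≤?_; nonNegative)
  open import Data.Rational.Properties
    using (+-identityʳ; +-monoʳ-≤; +-mono-≤; nonNegative⁻¹; normalize-nonNeg; normalize-coprime; nonNeg*nonNeg⇒nonNeg)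
  open import Data.Rational.Solver using (module +-*-Solver)
  open import Relation.Nullary.Decidable using (toWitness)
  open import Relation.Binary.PropositionalEquality
  open +-*-Solver

  ℕ→ℚ-+ : ∀ m n → ℕ→ℚ (m ℕ.+ n) ≡ ℕ→ℚ m + ℕ→ℚ n
  ℕ→ℚ-+ m n = trans (cong (_/ 1) (sym (cong₂ ℤ._+_ (ℤₚ.*-identityʳ (+ m)) (ℤₚ.*-identityʳ (+ n)))))
                    (sym (cong₂ _+_ (as-mkℚ m) (as-mkℚ n)))
    where
    as-mkℚ : ∀ m → ℕ→ℚ m ≡ mkℚ (+ m) 0 (Coprimality.sym (Coprimality.1-coprimeTo m))
    as-mkℚ m = normalize-coprime (Coprimality.sym (Coprimality.1-coprimeTo m))

  ℕ→ℚ-nonNeg : ∀ m → 0ℚ ≤ ℕ→ℚ m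
  ℕ→ℚ-nonNeg m = nonNegative⁻¹ (ℕ→ℚ m) {{normalize-nonNeg m 1}}

  ≤-by-slack : ∀ {x y} s → 0ℚ ≤ s → x + s ≡ y → x ≤ y
  ≤-by-slack {x} s 0≤s refl = subst (_≤ x + s) (+-identityʳ x) (+-monoʳ-≤ x 0≤s)

  nonNeg-+ : ∀ {x y} → 0ℚ ≤ x → 0ℚ ≤ y → 0ℚ ≤ x + y
  nonNeg-+ 0≤x 0≤y = +-mono-≤ 0≤x 0≤y

  nonNeg-* : ∀ {x y} → 0ℚ ≤ x → 0ℚ ≤ y → 0ℚ ≤ x * y
  nonNeg-* {x} {y} 0≤x 0≤y =
    nonNegative⁻¹ (x * y) {{nonNeg*nonNeg⇒nonNeg x {{nonNegative 0≤x}} y {{nonNegative 0≤y}}}}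

  δ-nonNeg : 0ℚ ≤ δ
  δ-nonNeg = toWitness {a? = 0ℚ ≤? δ} _

  ℕ→ℚ-∸ : ∀ {x y z} → x ℕ.+ y ≡ z → ℕ→ℚ x ≡ ℕ→ℚ z - ℕ→ℚ y
  ℕ→ℚ-∸ {x} {y} refl = trans (solve 2 (λ x y → x := (x :+ y) :- y) refl (ℕ→ℚ x) (ℕ→ℚ y))
                             (cong (_- ℕ→ℚ y) (sym (ℕ→ℚ-+ x y)))

  ℕ→ℚ-+₃ : ∀ a b c → ℕ→ℚ (a ℕ.+ b ℕ.+ c) ≡ ℕ→ℚ a + ℕ→ℚ b + ℕ→ℚ c
  ℕ→ℚ-+₃ a b c = trans (ℕ→ℚ-+ (a ℕ.+ b) c) (cong (_+ ℕ→ℚ c) (ℕ→ℚ-+ a b))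

  linear-estimate : ∀ c a d vR vW k eR eW se P₂ tR tWX st tW {v′ e′ t′} →
    0ℚ ≤ a → 0ℚ ≤ d → 0ℚ ≤ se → 0ℚ ≤ st →
    v′ ≡ vR + vW - k → e′ ≡ eR + eW + se - P₂ → t′ ≡ tR + tWX + st →
    c * v′ - a * e′ - d * t′ ≤ (c * vR - a * eR - d * tR) + (c * vW - a * eW - d * tW) - (c * k - a * P₂) + d * (tW - tWX)
  linear-estimate c a d vR vW k eR eW se P₂ tR tWX st tW 0≤a 0≤d 0≤se 0≤st refl refl refl =
    ≤-by-slack (a * se + d * st) (nonNeg-+ (nonNeg-* 0≤a 0≤se) (nonNeg-* 0≤d 0≤st))
      (solve 14 (λ c a d vR vW k eR eW se P₂ tR tWX st tW →
         c :* (vR :+ vW :- k) :- a :* (eR :+ eW :+ se :- P₂) :- d :* (tR :+ tWX :+ st) :+ (a :* se :+ d :* st)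
           := (c :* vR :- a :* eR :- d :* tR) :+ (c :* vW :- a :* eW :- d :* tW) :- (c :* k :- a :* P₂)
              :+ d :* (tW :- tWX)) refl c a d vR vW k eR eW se P₂ tR tWX st tW)

  potential-extension : ∀ {m m′} (GR GR′ : Graph m) (W : Graph m′) k tR tR′ tW tWX →
    nV GR′ ℕ.+ k ≡ nV GR ℕ.+ nV W → nE GR ℕ.+ nE W ℕ.≤ nE GR′ ℕ.+ k C 2 → tR ℕ.+ tWX ℕ.≤ tR′ →
    pot GR′ tR′ ≤ pot GR tR + pot W tW - f k + δ * (ℕ→ℚ tW - ℕ→ℚ tWX)
  potential-extension GR GR′ W k tR tR′ tW tWX vertices edges packings =
    let (se , edges′) = ℕₚ.m≤n⇒∃[o]m+o≡n edges ; (st , packings′) = ℕₚ.m≤n⇒∃[o]m+o≡n packings in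
    linear-estimate (ℕ→ℚ 9 + ε) (ℕ→ℚ 4) δ (ℕ→ℚ (nV GR)) (ℕ→ℚ (nV W)) (ℕ→ℚ k)
      (ℕ→ℚ (nE GR)) (ℕ→ℚ (nE W)) (ℕ→ℚ se) (ℕ→ℚ (k C 2)) (ℕ→ℚ tR) (ℕ→ℚ tWX) (ℕ→ℚ st) (ℕ→ℚ tW)
      {ℕ→ℚ (nV GR′)} {ℕ→ℚ (nE GR′)} {ℕ→ℚ tR′}
      (ℕ→ℚ-nonNeg 4) δ-nonNeg (ℕ→ℚ-nonNeg se) (ℕ→ℚ-nonNeg st)
      (trans (ℕ→ℚ-∸ {nV GR′} {k} vertices) (cong (_- ℕ→ℚ k) (ℕ→ℚ-+ (nV GR) (nV W))))
      (trans (ℕ→ℚ-∸ {nE GR′} {k C 2} (sym edges′)) (cong (_- ℕ→ℚ (k C 2)) (ℕ→ℚ-+₃ (nE GR) (nE W) se)))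
      (trans (cong ℕ→ℚ (sym packings′)) (ℕ→ℚ-+₃ tR tWX st))

  core-gain : ℕ → ℚ
  core-gain k = f k - ℕ→ℚ 9 - ε + δ - δ * ℕ→ℚ k

  core-gain-nonNeg : ∀ {k} → 1 ℕ.≤ k → k ℕ.≤ 4 → 0ℚ ≤ core-gain k
  core-gain-nonNeg {1} _ _ = toWitness {a? = 0ℚ ≤? core-gain 1} _
  core-gain-nonNeg {2} _ _ = toWitness {a? = 0ℚ ≤? core-gain 2} _
  core-gain-nonNeg {3} _ _ = toWitness {a? = 0ℚ ≤? core-gain 3} _
  core-gain-nonNeg {4} _ _ = toWitness {a? = 0ℚ ≤? core-gain 4} _
  core-gain-nonNeg {ℕ.suc (ℕ.suc (ℕ.suc (ℕ.suc (ℕ.suc _))))} _ (ℕ.s≤s (ℕ.s≤s (ℕ.s≤s (ℕ.s≤s ()))))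

  core-estimate : ∀ A F nine e d tWX k u {tW} →
    0ℚ ≤ F - nine - e + d - d * k → 0ℚ ≤ d → 0ℚ ≤ u → tW ≡ tWX + k - u →
    A - F + d * (tW - tWX) ≤ A - nine - e + d
  core-estimate A F nine e d tWX k u 0≤gain 0≤d 0≤u refl =
    ≤-by-slack ((F - nine - e + d - d * k) + d * u) (nonNeg-+ 0≤gain (nonNeg-* 0≤d 0≤u))
      (solve 8 (λ A F nine e d tWX k u →
         A :- F :+ d :* ((tWX :+ k :- u) :- tWX) :+ ((F :- nine :- e :+ d :- d :* k) :+ d :* u)
           := A :- nine :- e :+ d) refl A F nine e d tWX k u)

  core-bound : ∀ A k tW tWX → 1 ℕ.≤ k → k ℕ.≤ 4 → tW ℕ.≤ tWX ℕ.+ k →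
    A - f k + δ * (ℕ→ℚ tW - ℕ→ℚ tWX) ≤ A - ℕ→ℚ 9 - ε + δ
  core-bound A k tW tWX 1≤k k≤4 tW≤ =
    let (u , tW+u≡) = ℕₚ.m≤n⇒∃[o]m+o≡n tW≤ in
    core-estimate A (f k) (ℕ→ℚ 9) ε δ (ℕ→ℚ tWX) (ℕ→ℚ k) (ℕ→ℚ u) {ℕ→ℚ tW}
      (core-gain-nonNeg 1≤k k≤4) δ-nonNeg (ℕ→ℚ-nonNeg u)
      (trans (ℕ→ℚ-∸ {tW} {u} tW+u≡) (cong (_- ℕ→ℚ u) (ℕ→ℚ-+ tWX k)))

open import Data.Bool using (Bool; true; false)
open import Data.Nat using (ℕ; _≥_) renaming (_+_ to _+ℕ_)
open import Data.Fin using (Fin)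
open import Data.Product using (_×_; ∃-syntax)
open import Data.Rational using (_≤_; _+_; _-_; _*_)
open import Relation.Binary.PropositionalEquality using (_≡_; _≢_)
open import Data.Nat using (s≤s; z≤n)
import Data.Nat.Properties as ℕₚ
open import Data.Product using (_,_; proj₁; proj₂)
open import Data.Rational.Properties using (≤-trans)
open FiniteSums using (countF-witness)
open Potential using (potential-extension; core-bound)

lemma3p8 : ∀ {n} (G : Graph n) → Critical5 G →
    (R : Fin n → Bool) →
    (∀ v → R v ≡ true → V G v ≡ true) →
    (∃[ v ] (V G v ≡ true × R v ≡ false)) →
    countF R ≥ 5 →
    (φ : Fin n → Fin 4) →
    (∀ u v → Adj (induced G R) u v ≡ true → φ u ≢ φ v) →
    (W : Graph (n +ℕ 4)) → W ⊆G Gφ G R φ → Critical5 W →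
    ∀ tR tR' tW tWX →
    IsT (induced G R) tR →
    IsT (induced G (extension R W)) tR' →
    IsT W tW →
    IsT (minusCore W) tWX →
    (pot (induced G (extension R W)) tR'
       ≤ pot (induced G R) tR + pot W tW - f (coreSize W)
           + δ * (ℕ→ℚ tW - ℕ→ℚ tWX))
    × (pot (induced G (extension R W)) tR'
       ≤ pot (induced G R) tR + pot W tW - ℕ→ℚ 9 - ε + δ)
lemma3p8 {n} G G-critical R R⊆V _ |R|≥5 φ _ W W⊆Gφ W-critical tR tR' tW tWX TR TR' TW TWX =
  first , ≤-trans first second
  where
  open Extension G R φ W W⊆Gφ
  -- R is nonempty; a vertex of R also serves as the default point when moving W ∖ X onto V(G).
  v₀∈R : ∃[ v ] R v ≡ true
  v₀∈R = countF-witness R (ℕₚ.≤-trans (s≤s z≤n) |R|≥5)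
  v₀ : Fin n
  v₀ = proj₁ v₀∈R

  first : pot (induced G R') tR' ≤ pot (induced G R) tR + pot W tW - f k + δ * (ℕ→ℚ tW - ℕ→ℚ tWX)
  first = potential-extension (induced G R) (induced G R') W k tR tR' tW tWX
            vertex-count edge-count (T-grow v₀ TR TWX TR')

  second : pot (induced G R) tR + pot W tW - f k + δ * (ℕ→ℚ tW - ℕ→ℚ tWX)
           ≤ pot (induced G R) tR + pot W tW - ℕ→ℚ 9 - ε + δ
  second = core-bound (pot (induced G R) tR + pot W tW) k tW tWX
             (core-nonempty G-critical W-critical (R⊆V v₀ (proj₂ v₀∈R)) (proj₂ v₀∈R)) core≤4 (T-core TW TWX)
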